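{- Let $G$ be a hefty graph, let $H$ be a graph, and let $\mu$ be a blueprint of $H$ in $G$ whose defect is at most $0.3|V(G)|-|\mu(H)|$. Then $\mu$ extends to a model of $H$ in $G$, i.e. there is a model $\mu'$ of $H$ in $G$ with $\mu(v)\subseteq\mu'(v)$ for every $v\in V(H)$.
   Context: All graphs are finite and simple. A graph $G$ is hefty if $G=K_2$ or $\deg(v)\ge 0.65|V(G)|$ for every $v\in V(G)$. A blueprint of $H$ in $G$ is a map $\mu$ sending the vertices of $H$ to pairwise disjoint subsets of $V(G)$ (the bags); $\mu(H)=\bigcup_{v\in V(H)}\mu(v)$. A blueprint is a premodel if for every edge $uv\in E(H)$ some edge of $G$ has one end in $\mu(u)$ and the other in $\mu(v)$; a premodel is a model if $G[\mu(v)]$ is connected for every $v\in V(H)$. A set $F$ of pairs of vertices of $G$ is a completion of $\mu$ if $\mu$ is a model of $H$ in the graph obtained from $G$ by adding the pairs in $F$ as edges. The defect of $\mu$ is the minimum size of a completion of $\mu$. -}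

module Defs where

open import Data.Nat using (ℕ; zero; suc; _+_; _*_; _≤_)
open import Data.Fin using (Fin)
open import Data.Bool using (Bool; true; false)
open import Data.Vec using (tabulate)
open import Data.Fin.Subset using (Subset; _∈_; _⊆_; ∣_∣)
open import Data.List using (List; length)
open import Data.List.Membership.Propositional renaming (_∈_ to _∈ₗ_)
open import Data.Product using (Σ; ∃; _×_; _,_)
open import Data.Sum using (_⊎_)
open import Data.Empty using (⊥)
open import Relation.Binary.PropositionalEquality using (_≡_; _≢_)

record Graph : Set where
  field
    size  : ℕ
    adj   : Fin size → Fin size → Bool
    sym   : ∀ u v → adj u v ≡ adj v u
    irrefl : ∀ v → adj v v ≡ false
open Graph public

Edge : (G : Graph) → Fin (size G) → Fin (size G) → Set
Edge G u v = adj G u v ≡ true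

nbhd : (G : Graph) → Fin (size G) → Subset (size G)
nbhd G v = tabulate (λ u → adj G v u)

deg : (G : Graph) → Fin (size G) → ℕ
deg G v = ∣ nbhd G v ∣

IsK2 : Graph → Set
IsK2 G = Σ (size G ≡ 2) λ _ →
           Σ (Fin (size G)) λ a → Σ (Fin (size G)) λ b → Edge G a b

-- hefty: G = K₂ or deg(v) ≥ 0.65 |V(G)| for all v, i.e. 20·deg(v) ≥ 13·|V(G)|
Hefty : Graph → Set
Hefty G = IsK2 G ⊎ (∀ v → 13 * size G ≤ 20 * deg G v)

Blueprint : (H G : Graph) → Set
Blueprint H G = Σ (Fin (size H) → Subset (size G)) λ μ →
  ∀ u v → u ≢ v → ∀ x → x ∈ μ u → x ∈ μ v → ⊥

bags : ∀ {H} {G} → Blueprint H G → Fin (size H) → Subset (size G)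
bags (μ , _) = μ

-- |μ(H)| : total size of the (disjoint) bags
sumFin : (k : ℕ) → (Fin k → ℕ) → ℕ
sumFin zero    f = 0
sumFin (suc k) f = f Fin.zero + sumFin k (λ i → f (Fin.suc i))

imageSize : ∀ {H G} → Blueprint H G → ℕ
imageSize {H} {G} μ = sumFin (size H) (λ v → ∣ bags {H} {G} μ v ∣)

data Walk {n : ℕ} (E : Fin n → Fin n → Set) (S : Subset n) : Fin n → Fin n → Set where
  here : ∀ {x} → x ∈ S → Walk E S x x
  step : ∀ {x y z} → x ∈ S → E x y → Walk E S y z → Walk E S x z

Connected : {n : ℕ} → (Fin n → Fin n → Set) → Subset n → Set
Connected {n} E S = (Σ (Fin n) λ x → x ∈ S) × (∀ x y → x ∈ S → y ∈ S → Walk E S x y)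

IsPremodelFor : (H : Graph) {n : ℕ} → (Fin n → Fin n → Set) → (Fin (size H) → Subset n) → Set
IsPremodelFor H {n} E μ = ∀ u v → Edge H u v →
  Σ (Fin n) λ x → Σ (Fin n) λ y → x ∈ μ u × y ∈ μ v × E x y

IsModelFor : (H : Graph) {n : ℕ} → (Fin n → Fin n → Set) → (Fin (size H) → Subset n) → Set
IsModelFor H E μ = IsPremodelFor H E μ × (∀ v → Connected E (μ v))

IsModel : (H G : Graph) → Blueprint H G → Set
IsModel H G μ = IsModelFor H (Edge G) (bags {H} {G} μ)

EdgePlus : (G : Graph) → List (Fin (size G) × Fin (size G)) → Fin (size G) → Fin (size G) → Set
EdgePlus G F x y = Edge G x y ⊎ ((x , y) ∈ₗ F ⊎ (y , x) ∈ₗ F)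

IsCompletion : (H G : Graph) → Blueprint H G → List (Fin (size G) × Fin (size G)) → Set
IsCompletion H G μ F = IsModelFor H (EdgePlus G F) (bags {H} {G} μ)

-- defect(μ) ≤ k  ⇔  μ has a completion of size ≤ k  (defect = minimum completion size)
DefectAtMost : (H G : Graph) → Blueprint H G → ℕ → Set
DefectAtMost H G μ k = Σ (List (Fin (size G) × Fin (size G))) λ F → IsCompletion H G μ F × length F ≤ k

-- Fix a completion F of μ with |F| ≤ d and let U be the union of the
-- bags.  We remove the pairs of F one at a time.  For a missing pair (x , y), the
-- minimum degree 0.65|V(G)| gives |N(x)| + |N(y)| > |U| + |V(G)| as long as
-- 0.3|V(G)| ≥ |U| + |F|, so x and y have a common neighbour z outside U.  Adding z
-- to the bag containing x (if any) replaces the virtual edge xy by the path x z y: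
-- the result is a model in G + (F − xy), its bags lie in U ∪ {z}, and the budget
-- |U| + |F| does not grow.  When F is empty the completion is a model of H in G.
module Submission where

open import Defs
open import Data.Nat using (ℕ; _+_; _*_; _≤_)
open import Data.Product using (Σ; _×_)
open import Data.Fin.Subset using (_⊆_)

open import Data.Nat using (zero; suc; _<_; _≤?_; z≤n; s≤s)
open import Data.Nat.Properties
open import Data.Nat.Tactic.RingSolver using (solve)
open import Data.Bool using (true; false)
open import Data.Vec using ([]; _∷_)
open import Data.Vec.Properties using ([]=⇒lookup; lookup∘tabulate)
open import Data.Fin using (Fin)
import Data.Fin as Fin
open import Data.Fin.Subset
  using (Subset; _∈_; _∉_; ∣_∣; _∪_; _∩_; ∁; ⁅_⁆; Nonempty) renaming (⊥ to ∅)
open import Data.Fin.Subset.Properties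
  using ( _∈?_; nonempty?; Empty-unique; ∣⊥∣≡0; ∣p∣≤n; ∣∁p∣≡n∸∣p∣; ∣⁅x⁆∣≡1
        ; p⊆p∪q; q⊆p∪q; x∈p∪q⁻; x∈p∩q⁻; x∈∁p⇒x∉p; x∈⁅x⁆; x∈⁅y⁆⇒x≡y; ∉⊥ )
open import Data.Product using (_,_; proj₁; proj₂)
open import Data.Sum using (inj₁; inj₂)
open import Data.Empty using (⊥; ⊥-elim)
open import Data.List using (List; []; _∷_; length)
import Data.List as List
open import Data.List.Relation.Unary.Any using (here; there)
open import Relation.Binary.PropositionalEquality
  using (_≡_; refl; trans; cong; subst; _≢_)
  renaming (sym to ≡-sym)
open import Relation.Nullary using (yes; no; contradiction)
open import Relation.Nullary.Decidable using (from-no)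
open import Function using (id; _∘_)

∣p∪q∣+∣p∩q∣≡∣p∣+∣q∣ : ∀ {n} (p q : Subset n) → ∣ p ∪ q ∣ + ∣ p ∩ q ∣ ≡ ∣ p ∣ + ∣ q ∣
∣p∪q∣+∣p∩q∣≡∣p∣+∣q∣ []          []          = refl
∣p∪q∣+∣p∩q∣≡∣p∣+∣q∣ (true ∷ p)  (true ∷ q)  =
  cong suc (trans (+-suc _ _)
                  (trans (cong suc (∣p∪q∣+∣p∩q∣≡∣p∣+∣q∣ p q)) (≡-sym (+-suc _ _))))
∣p∪q∣+∣p∩q∣≡∣p∣+∣q∣ (true ∷ p)  (false ∷ q) = cong suc (∣p∪q∣+∣p∩q∣≡∣p∣+∣q∣ p q)
∣p∪q∣+∣p∩q∣≡∣p∣+∣q∣ (false ∷ p) (true ∷ q)  =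
  trans (cong suc (∣p∪q∣+∣p∩q∣≡∣p∣+∣q∣ p q)) (≡-sym (+-suc _ _))
∣p∪q∣+∣p∩q∣≡∣p∣+∣q∣ (false ∷ p) (false ∷ q) = ∣p∪q∣+∣p∩q∣≡∣p∣+∣q∣ p q

∣p∪q∣≤∣p∣+∣q∣ : ∀ {n} (p q : Subset n) → ∣ p ∪ q ∣ ≤ ∣ p ∣ + ∣ q ∣
∣p∪q∣≤∣p∣+∣q∣ p q = ≤-trans (m≤m+n _ ∣ p ∩ q ∣) (≤-reflexive (∣p∪q∣+∣p∩q∣≡∣p∣+∣q∣ p q))

∣p∣+∣q∣≤n+∣p∩q∣ : ∀ {n} (p q : Subset n) → ∣ p ∣ + ∣ q ∣ ≤ n + ∣ p ∩ q ∣
∣p∣+∣q∣≤n+∣p∩q∣ p q = begin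
  ∣ p ∣ + ∣ q ∣         ≡⟨ ≡-sym (∣p∪q∣+∣p∩q∣≡∣p∣+∣q∣ p q) ⟩
  ∣ p ∪ q ∣ + ∣ p ∩ q ∣ ≤⟨ +-monoˡ-≤ ∣ p ∩ q ∣ (∣p∣≤n (p ∪ q)) ⟩
  _ + ∣ p ∩ q ∣         ∎
  where open ≤-Reasoning

∣p∣+∣∁p∣≡n : ∀ {n} (p : Subset n) → ∣ p ∣ + ∣ ∁ p ∣ ≡ n
∣p∣+∣∁p∣≡n p = trans (cong (∣ p ∣ +_) (∣∁p∣≡n∸∣p∣ p)) (m+[n∸m]≡n (∣p∣≤n p))

nonempty-if-positive : ∀ {n} (p : Subset n) → 0 < ∣ p ∣ → Nonempty p
nonempty-if-positive {n} p 0<∣p∣ with nonempty? p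
... | yes ne    = ne
... | no  empty = contradiction (subst (λ s → 0 < ∣ s ∣) (Empty-unique empty) 0<∣p∣)
                                (<-irrefl (≡-sym (∣⊥∣≡0 n)))

-- Pigeonhole: if |p| + |q| exceeds |U| + n, some element of p ∩ q avoids U.
-- Indeed |p ∩ q| > |U|, so |p ∩ q| + |∁U| > n, forcing (p ∩ q) ∩ ∁U ≠ ∅.
pigeonhole : ∀ {n} (p q U : Subset n) → ∣ U ∣ + n < ∣ p ∣ + ∣ q ∣ → Nonempty ((p ∩ q) ∩ ∁ U)
pigeonhole {n} p q U big = nonempty-if-positive (A ∩ ∁ U) (+-cancelˡ-< n 0 _ n<n+c)
  where
  A : Subset n
  A = p ∩ q

  ∣U∣<∣A∣ : ∣ U ∣ < ∣ A ∣
  ∣U∣<∣A∣ = +-cancelˡ-< n _ _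
    (subst (_< n + ∣ A ∣) (+-comm ∣ U ∣ n) (<-≤-trans big (∣p∣+∣q∣≤n+∣p∩q∣ p q)))

  n<n+c : n + 0 < n + ∣ A ∩ ∁ U ∣
  n<n+c = begin-strict
    n + 0                  ≡⟨ +-identityʳ n ⟩
    n                      ≡⟨ ≡-sym (∣p∣+∣∁p∣≡n U) ⟩
    ∣ U ∣ + ∣ ∁ U ∣        <⟨ +-monoˡ-< ∣ ∁ U ∣ ∣U∣<∣A∣ ⟩
    ∣ A ∣ + ∣ ∁ U ∣        ≤⟨ ∣p∣+∣q∣≤n+∣p∩q∣ A (∁ U) ⟩
    n + ∣ A ∩ ∁ U ∣        ∎
    where open ≤-Reasoning

⋃ᶠ : ∀ {n} k → (Fin k → Subset n) → Subset n
⋃ᶠ zero    f = ∅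
⋃ᶠ (suc k) f = f Fin.zero ∪ ⋃ᶠ k (f ∘ Fin.suc)

⊆⋃ᶠ : ∀ {n} k (f : Fin k → Subset n) i → f i ⊆ ⋃ᶠ k f
⊆⋃ᶠ (suc k) f Fin.zero    = p⊆p∪q _
⊆⋃ᶠ (suc k) f (Fin.suc i) = q⊆p∪q (f Fin.zero) _ ∘ ⊆⋃ᶠ k (f ∘ Fin.suc) i

∣⋃ᶠ∣≤sum : ∀ {n} k (f : Fin k → Subset n) → ∣ ⋃ᶠ k f ∣ ≤ sumFin k (λ i → ∣ f i ∣)
∣⋃ᶠ∣≤sum {n} zero f = ≤-reflexive (∣⊥∣≡0 n)
∣⋃ᶠ∣≤sum (suc k) f =
  ≤-trans (∣p∪q∣≤∣p∣+∣q∣ (f Fin.zero) _)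
          (+-monoʳ-≤ ∣ f Fin.zero ∣ (∣⋃ᶠ∣≤sum k (f ∘ Fin.suc)))

edge-sym : ∀ (G : Graph) {a b} → Edge G a b → Edge G b a
edge-sym G {a} {b} e = trans (Graph.sym G b a) e

∈nbhd⇒Edge : ∀ (G : Graph) {x z} → z ∈ nbhd G x → Edge G x z
∈nbhd⇒Edge G {x} {z} z∈N = trans (≡-sym (lookup∘tabulate (adj G x) z)) ([]=⇒lookup z∈N)

hefty-surplus : ∀ u n a b → 13 * n ≤ 20 * a → 13 * n ≤ 20 * b → 10 * suc u ≤ 3 * n →
                u + n < a + b
hefty-surplus u n a b 13n≤20a 13n≤20b room = *-cancelˡ-≤ 20 (begin
  20 * suc (u + n)          ≡⟨ regroup ⟩
  2 * (10 * suc u) + 20 * n ≤⟨ +-monoˡ-≤ (20 * n) (*-monoʳ-≤ 2 room) ⟩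
  2 * (3 * n) + 20 * n      ≡⟨ split ⟩
  13 * n + 13 * n           ≤⟨ +-mono-≤ 13n≤20a 13n≤20b ⟩
  20 * a + 20 * b           ≡⟨ ≡-sym (*-distribˡ-+ 20 a b) ⟩
  20 * (a + b)              ∎)
  where
  open ≤-Reasoning

  regroup : 20 * suc (u + n) ≡ 2 * (10 * suc u) + 20 * n
  regroup = solve (u List.∷ n List.∷ List.[])

  split : 2 * (3 * n) + 20 * n ≡ 13 * n + 13 * n
  split = solve (n List.∷ List.[])

common-neighbour-outside : ∀ (G : Graph) → (∀ v → 13 * size G ≤ 20 * deg G v) →
  ∀ x y (U : Subset (size G)) → 10 * suc ∣ U ∣ ≤ 3 * size G →
  Σ (Fin (size G)) λ z → Edge G x z × Edge G y z × z ∉ U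
common-neighbour-outside G mindeg x y U room =
  z , ∈nbhd⇒Edge G z∈Nx , ∈nbhd⇒Edge G z∈Ny , x∈∁p⇒x∉p z∈∁U
  where
  Nx Ny : Subset (size G)
  Nx = nbhd G x
  Ny = nbhd G y

  witness : Nonempty ((Nx ∩ Ny) ∩ ∁ U)
  witness = pigeonhole Nx Ny U
    (hefty-surplus ∣ U ∣ (size G) (deg G x) (deg G y) (mindeg x) (mindeg y) room)

  z : Fin (size G)
  z = proj₁ witness

  z∈Nx∩Ny : z ∈ Nx ∩ Ny
  z∈Nx∩Ny = proj₁ (x∈p∩q⁻ (Nx ∩ Ny) (∁ U) (proj₂ witness))

  z∈∁U : z ∈ ∁ U
  z∈∁U = proj₂ (x∈p∩q⁻ (Nx ∩ Ny) (∁ U) (proj₂ witness))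

  z∈Nx : z ∈ Nx
  z∈Nx = proj₁ (x∈p∩q⁻ Nx Ny z∈Nx∩Ny)

  z∈Ny : z ∈ Ny
  z∈Ny = proj₂ (x∈p∩q⁻ Nx Ny z∈Nx∩Ny)

walk-start : ∀ {n} {E : Fin n → Fin n → Set} {S a b} → Walk E S a b → a ∈ S
walk-start (here a∈S)     = a∈S
walk-start (step a∈S _ _) = a∈S

walk-++ : ∀ {n} {E : Fin n → Fin n → Set} {S a b c} →
  Walk E S a b → Walk E S b c → Walk E S a c
walk-++ (here _)       w′ = w′
walk-++ (step a∈ e w) w′ = step a∈ e (walk-++ w w′)

walk-map : ∀ {n} {E E′ : Fin n → Fin n → Set} {S S′ : Subset n} {a b} → S ⊆ S′ →
  (∀ {c d} → c ∈ S → d ∈ S → E c d → Walk E′ S′ c d) → Walk E S a b → Walk E′ S′ a b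
walk-map S⊆S′ edge-walk (here a∈)     = here (S⊆S′ a∈)
walk-map S⊆S′ edge-walk (step a∈ e w) =
  walk-++ (edge-walk a∈ (walk-start w) e) (walk-map S⊆S′ edge-walk w)

model-mono : ∀ (H : Graph) {n} {E E′ : Fin n → Fin n → Set} {β : Fin (size H) → Subset n} →
  (∀ {a b} → E a b → E′ a b) → IsModelFor H E β → IsModelFor H E′ β
model-mono H E⊆E′ (premodel , connected) =
  (λ u v uv → let (a , b , a∈ , b∈ , e) = premodel u v uv in a , b , a∈ , b∈ , E⊆E′ e) ,
  λ v → proj₁ (connected v) , λ a b a∈ b∈ →
    walk-map id (λ c∈ d∈ e → step c∈ (E⊆E′ e) (here d∈)) (proj₂ (connected v) a b a∈ b∈)

EdgePlus[]⇒Edge : ∀ (G : Graph) {a b} → EdgePlus G [] a b → Edge G a b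
EdgePlus[]⇒Edge G (inj₁ e)         = e
EdgePlus[]⇒Edge G (inj₂ (inj₁ ()))
EdgePlus[]⇒Edge G (inj₂ (inj₂ ()))

ExtendsToModel : (H G : Graph) → Blueprint H G → Set
ExtendsToModel H G μ =
  Σ (Blueprint H G) λ μ′ → IsModel H G μ′ × (∀ v → bags {H} {G} μ v ⊆ bags {H} {G} μ′ v)

empty-completion-model : ∀ (H G : Graph) (μ : Blueprint H G) →
  IsCompletion H G μ [] → ExtendsToModel H G μ
empty-completion-model H G μ C = μ , model-mono H (EdgePlus[]⇒Edge G) C , λ v → id

-- Rerouting one missing pair (x , y) through a common neighbour z ∉ U, where U
-- contains all bags: z joins the bag containing x (there is at most one).
module Reroute (G H : Graph) {x y z : Fin (size G)} (xz : Edge G x z) (yz : Edge G y z)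
  (U : Subset (size G)) (z∉U : z ∉ U) (F : List (Fin (size G) × Fin (size G)))
  (μ : Blueprint H G) (μ⊆U : ∀ v → bags {H} {G} μ v ⊆ U) where

  β : Fin (size H) → Subset (size G)
  β = bags {H} {G} μ

  joiner : Fin (size H) → Subset (size G)
  joiner v with x ∈? β v
  ... | yes _ = ⁅ z ⁆
  ... | no  _ = ∅

  β′ : Fin (size H) → Subset (size G)
  β′ v = β v ∪ joiner v

  joiner⁻ : ∀ v {a} → a ∈ joiner v → a ≡ z × x ∈ β v
  joiner⁻ v a∈ with x ∈? β v
  ... | yes x∈ = x∈⁅y⁆⇒x≡y z a∈ , x∈
  ... | no  _  = ⊥-elim (∉⊥ a∈)

  joiner⁺ : ∀ v → x ∈ β v → z ∈ joiner v
  joiner⁺ v x∈ with x ∈? β v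
  ... | yes _  = x∈⁅x⁆ z
  ... | no  x∉ = contradiction x∈ x∉

  β⊆β′ : ∀ v → β v ⊆ β′ v
  β⊆β′ v = p⊆p∪q (joiner v)

  z∈β′ : ∀ v → x ∈ β v → z ∈ β′ v
  z∈β′ v x∈ = q⊆p∪q (β v) (joiner v) (joiner⁺ v x∈)

  E E′ : Fin (size G) → Fin (size G) → Set
  E  = EdgePlus G ((x , y) ∷ F)
  E′ = EdgePlus G F

  -- Each edge of G + xy + F inside a bag is a walk in G + F inside the new bag;
  -- the pair xy itself becomes x z y.
  edge-walk : ∀ v {a b} → a ∈ β v → b ∈ β v → E a b → Walk E′ (β′ v) a b
  edge-walk v a∈ b∈ (inj₁ e) = step (β⊆β′ v a∈) (inj₁ e) (here (β⊆β′ v b∈))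
  edge-walk v a∈ b∈ (inj₂ (inj₁ (there ab∈F))) =
    step (β⊆β′ v a∈) (inj₂ (inj₁ ab∈F)) (here (β⊆β′ v b∈))
  edge-walk v a∈ b∈ (inj₂ (inj₂ (there ba∈F))) =
    step (β⊆β′ v a∈) (inj₂ (inj₂ ba∈F)) (here (β⊆β′ v b∈))
  edge-walk v a∈ b∈ (inj₂ (inj₁ (here refl))) =
    step (β⊆β′ v a∈) (inj₁ xz) (step (z∈β′ v a∈) (inj₁ (edge-sym G yz)) (here (β⊆β′ v b∈)))
  edge-walk v a∈ b∈ (inj₂ (inj₂ (here refl))) =
    step (β⊆β′ v a∈) (inj₁ yz) (step (z∈β′ v b∈) (inj₁ (edge-sym G xz)) (here (β⊆β′ v b∈)))

  -- An edge of H realised by the pair xy is now realised by the edge zy or yz.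
  premodel : IsPremodelFor H E β → IsPremodelFor H E′ β′
  premodel P u v uv with P u v uv
  ... | a , b , a∈ , b∈ , inj₁ e =
    a , b , β⊆β′ u a∈ , β⊆β′ v b∈ , inj₁ e
  ... | a , b , a∈ , b∈ , inj₂ (inj₁ (there ab∈F)) =
    a , b , β⊆β′ u a∈ , β⊆β′ v b∈ , inj₂ (inj₁ ab∈F)
  ... | a , b , a∈ , b∈ , inj₂ (inj₂ (there ba∈F)) =
    a , b , β⊆β′ u a∈ , β⊆β′ v b∈ , inj₂ (inj₂ ba∈F)
  ... | a , b , a∈ , b∈ , inj₂ (inj₁ (here refl)) =
    z , b , z∈β′ u a∈ , β⊆β′ v b∈ , inj₁ (edge-sym G yz)
  ... | a , b , a∈ , b∈ , inj₂ (inj₂ (here refl)) =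
    a , z , β⊆β′ u a∈ , z∈β′ v b∈ , inj₁ yz

  -- The new bag stays connected: z is attached to x, which lies in the old bag.
  connected : ∀ v → Connected E (β v) → Connected E′ (β′ v)
  connected v ((w , w∈) , walks) = (w , β⊆β′ v w∈) , walks′
    where
    old : ∀ a b → a ∈ β v → b ∈ β v → Walk E′ (β′ v) a b
    old a b a∈ b∈ = walk-map (β⊆β′ v) (edge-walk v) (walks a b a∈ b∈)

    walks′ : ∀ a b → a ∈ β′ v → b ∈ β′ v → Walk E′ (β′ v) a b
    walks′ a b a∈ b∈ with x∈p∪q⁻ (β v) (joiner v) a∈ | x∈p∪q⁻ (β v) (joiner v) b∈
    ... | inj₁ a∈β | inj₁ b∈β = old a b a∈β b∈β
    ... | inj₂ a∈J | inj₁ b∈β with joiner⁻ v a∈J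
    ...   | refl , x∈ = step a∈ (inj₁ (edge-sym G xz)) (old x b x∈ b∈β)
    walks′ a b a∈ b∈ | inj₁ a∈β | inj₂ b∈J with joiner⁻ v b∈J
    ...   | refl , x∈ = walk-++ (old a x a∈β x∈) (step (β⊆β′ v x∈) (inj₁ xz) (here b∈))
    walks′ a b a∈ b∈ | inj₂ a∈J | inj₂ b∈J with joiner⁻ v a∈J | joiner⁻ v b∈J
    ...   | refl , _ | refl , _ = here a∈

  -- z is new (outside U), and it joins only the unique bag containing x.
  disjoint : ∀ u v → u ≢ v → ∀ a → a ∈ β′ u → a ∈ β′ v → ⊥
  disjoint u v u≢v a a∈u a∈v with x∈p∪q⁻ (β u) (joiner u) a∈u | x∈p∪q⁻ (β v) (joiner v) a∈v
  ... | inj₁ a∈βu | inj₁ a∈βv = proj₂ μ u v u≢v a a∈βu a∈βv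
  ... | inj₂ a∈Ju | inj₁ a∈βv with joiner⁻ u a∈Ju
  ...   | refl , _ = z∉U (μ⊆U v a∈βv)
  disjoint u v u≢v a a∈u a∈v | inj₁ a∈βu | inj₂ a∈Jv with joiner⁻ v a∈Jv
  ...   | refl , _ = z∉U (μ⊆U u a∈βu)
  disjoint u v u≢v a a∈u a∈v | inj₂ a∈Ju | inj₂ a∈Jv =
    proj₂ μ u v u≢v x (proj₂ (joiner⁻ u a∈Ju)) (proj₂ (joiner⁻ v a∈Jv))

  μ′ : Blueprint H G
  μ′ = β′ , disjoint

  μ′⊆U∪z : ∀ v → β′ v ⊆ U ∪ ⁅ z ⁆
  μ′⊆U∪z v a∈ with x∈p∪q⁻ (β v) (joiner v) a∈
  ... | inj₁ a∈β = p⊆p∪q ⁅ z ⁆ (μ⊆U v a∈β)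
  ... | inj₂ a∈J with joiner⁻ v a∈J
  ...   | refl , _ = q⊆p∪q U ⁅ z ⁆ (x∈⁅x⁆ z)

reroute : ∀ (G H : Graph) {x y z} → Edge G x z → Edge G y z →
  (U : Subset (size G)) → z ∉ U → (F : List (Fin (size G) × Fin (size G))) →
  (μ : Blueprint H G) → (∀ v → bags {H} {G} μ v ⊆ U) → IsCompletion H G μ ((x , y) ∷ F) →
  Σ (Blueprint H G) λ μ′ → IsCompletion H G μ′ F ×
    (∀ v → bags {H} {G} μ′ v ⊆ U ∪ ⁅ z ⁆) × (∀ v → bags {H} {G} μ v ⊆ bags {H} {G} μ′ v)
reroute G H xz yz U z∉U F μ μ⊆U (P , C) =
  μ′ , (premodel P , λ v → connected v (C v)) , μ′⊆U∪z , β⊆β′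
  where open Reroute G H xz yz U z∉U F μ μ⊆U

extend-along : ∀ (G H : Graph) → (∀ v → 13 * size G ≤ 20 * deg G v) →
  (F : List (Fin (size G) × Fin (size G))) (μ : Blueprint H G) → IsCompletion H G μ F →
  (U : Subset (size G)) → (∀ v → bags {H} {G} μ v ⊆ U) →
  10 * (∣ U ∣ + length F) ≤ 3 * size G → ExtendsToModel H G μ
extend-along G H mindeg [] μ C U μ⊆U budget = empty-completion-model H G μ C
extend-along G H mindeg ((x , y) ∷ F) μ C U μ⊆U budget =
  let (z , xz , yz , z∉U)        = common-neighbour-outside G mindeg x y U room
      (μ′ , C′ , μ′⊆U∪z , μ⊆μ′) = reroute G H xz yz U z∉U F μ μ⊆U C
      (μ″ , model , μ′⊆μ″)      = extend-along G H mindeg F μ′ C′ (U ∪ ⁅ z ⁆) μ′⊆U∪z (budget′ z)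
  in μ″ , model , λ v → μ′⊆μ″ v ∘ μ⊆μ′ v
  where
  room : 10 * suc ∣ U ∣ ≤ 3 * size G
  room = ≤-trans (*-monoʳ-≤ 10 (m≤m+n (suc ∣ U ∣) (length F)))
                 (≤-trans (≤-reflexive (cong (10 *_) (≡-sym (+-suc ∣ U ∣ (length F))))) budget)

  -- Adding z costs one vertex of U and saves one pair of F.
  budget′ : ∀ z → 10 * (∣ U ∪ ⁅ z ⁆ ∣ + length F) ≤ 3 * size G
  budget′ z = ≤-trans (*-monoʳ-≤ 10 (+-monoˡ-≤ (length F) ∣U∪z∣≤1+∣U∣))
                      (≤-trans (≤-reflexive (cong (10 *_) (≡-sym (+-suc ∣ U ∣ (length F))))) budget)
    where
    ∣U∪z∣≤1+∣U∣ : ∣ U ∪ ⁅ z ⁆ ∣ ≤ suc ∣ U ∣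
    ∣U∪z∣≤1+∣U∣ = ≤-trans (∣p∪q∣≤∣p∣+∣q∣ U ⁅ z ⁆)
      (≤-reflexive (trans (cong (∣ U ∣ +_) (∣⁅x⁆∣≡1 z)) (+-comm ∣ U ∣ 1)))

K2-no-completion : ∀ {A : Set} (F : List A) d s → length F ≤ d → 10 * (d + s) ≤ 3 * 2 → F ≡ []
K2-no-completion []      d s _   _      = refl
K2-no-completion (_ ∷ _) d s |F|≤d budget =
  contradiction (≤-trans (*-monoʳ-≤ 10 (≤-trans (≤-trans (s≤s z≤n) |F|≤d) (m≤m+n d s))) budget)
                (from-no (10 ≤? 6))

lemma6p2 : (G H : Graph) → Hefty G → (μ : Blueprint H G) → (d : ℕ) →
    DefectAtMost H G μ d → 10 * (d + imageSize {H} {G} μ) ≤ 3 * size G →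
    Σ (Blueprint H G) λ μ′ → IsModel H G μ′ × (∀ v → bags {H} {G} μ v ⊆ bags {H} {G} μ′ v)
lemma6p2 G H (inj₁ (size≡2 , _)) μ d (F , C , |F|≤d) budget
  with K2-no-completion F d (imageSize {H} {G} μ) |F|≤d
         (subst (λ n → 10 * (d + imageSize {H} {G} μ) ≤ 3 * n) size≡2 budget)
... | refl = empty-completion-model H G μ C
lemma6p2 G H (inj₂ mindeg) μ d (F , C , |F|≤d) budget =
  extend-along G H mindeg F μ C U (⊆⋃ᶠ (size H) β) U-budget
  where
  β : Fin (size H) → Subset (size G)
  β = bags {H} {G} μ

  U : Subset (size G)
  U = ⋃ᶠ (size H) β

  U-budget : 10 * (∣ U ∣ + length F) ≤ 3 * size G
  U-budget = ≤-trans (*-monoʳ-≤ 10 (≤-trans (+-mono-≤ (∣⋃ᶠ∣≤sum (size H) β) |F|≤d)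
                                            (≤-reflexive (+-comm (imageSize {H} {G} μ) d))))
                     budget
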